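{- Let $\mathcal{F}$ be a strong greedoid on a finite ground set $E$. Let $D\subseteq E$ and let $x,y,z\in E\setminus D$. Assume $D\cup\{x,z\}\in\mathcal{F}$, $D\cup\{y\}\in\mathcal{F}$ and $D\cup\{z\}\notin\mathcal{F}$. Then $D\cup\{y,z\}\in\mathcal{F}$.
   Context: A collection $\mathcal{F}$ of subsets of a finite set $E$ is a greedoid if: (i) $\varnothing\in\mathcal{F}$; (ii) if $B\in\mathcal{F}$ and $|B|>0$, there is $b\in B$ with $B\setminus\{b\}\in\mathcal{F}$; (iii) if $A,B\in\mathcal{F}$ with $|B|=|A|+1$, there is $b\in B\setminus A$ with $A\cup\{b\}\in\mathcal{F}$. A greedoid is a strong greedoid if moreover: (iv) whenever $A,B\in\mathcal{F}$ with $|B|=|A|+1$, there is $x\in B\setminus A$ such that $A\cup\{x\}\in\mathcal{F}$ and $B\setminus\{x\}\in\mathcal{F}$. -}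

module Defs where

open import Data.Nat using (ℕ; _+_; _<_)
open import Data.Fin using (Fin)
open import Data.Fin.Subset using (Subset; ⊥; _∈_; _∉_; _∪_; _-_; ⁅_⁆; ∣_∣)
open import Data.Product using (Σ; ∃; _×_; _,_)
open import Relation.Binary.PropositionalEquality using (_≡_)
open import Level using (Level)

-- A set system on the ground set E = Fin n is a predicate on subsets:
-- F X means "X ∈ 𝓕".

record IsGreedoid {ℓ : Level} (n : ℕ) (F : Subset n → Set ℓ) : Set ℓ where
  field
    empty    : F ⊥
    access   : ∀ B → 0 < ∣ B ∣ → F B → Σ (Fin n) λ b → b ∈ B × F (B - b)
    exchange : ∀ A B → F A → F B → ∣ B ∣ ≡ ∣ A ∣ + 1 →
               Σ (Fin n) λ b → b ∈ B × b ∉ A × F (A ∪ ⁅ b ⁆)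

record IsStrongGreedoid {ℓ : Level} (n : ℕ) (F : Subset n → Set ℓ) : Set ℓ where
  field
    isGreedoid     : IsGreedoid n F
    strongExchange : ∀ A B → F A → F B → ∣ B ∣ ≡ ∣ A ∣ + 1 →
                     Σ (Fin n) λ x → x ∈ B × x ∉ A × F (A ∪ ⁅ x ⁆) × F (B - x)

module Submission where

-- Put A = D ∪ {y} and B = D ∪ {x, z}; both are feasible and
-- |B| = |A| + 1.  Strong exchange yields w ∈ B ∖ A with A ∪ {w} feasible and
-- B ∖ {w} feasible.  Since B ∖ {x} = D ∪ {z} is infeasible, w ≠ x; since
-- w ∉ A ⊇ D, the only remaining element of B is z, so w = z and
-- A ∪ {z} = D ∪ {y, z} is feasible.

open import Defs
open import Data.Nat using (ℕ; suc; _+_)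
open import Data.Nat.Properties using (+-comm)
open import Data.Fin using (Fin; zero; suc)
open import Data.Fin.Subset using (Subset; ⊥; _∈_; _∉_; _∪_; _─_; _-_; ⁅_⁆; ∣_∣; inside; outside)
open import Data.Fin.Subset.Properties
  using (x∈⁅y⁆⇒x≡y; x∈p∪q⁻; p⊆p∪q; ∪-assoc; ∪-comm; ∪-idem; ∪-identityʳ; p─⊥≡p)
open import Data.Vec using (_∷_)
open import Data.Vec.Base using (here; there)
open import Data.Product using (Σ; _×_; _,_)
open import Data.Sum using (inj₁; inj₂)
open import Data.Empty using (⊥-elim)
open import Function using (_∘_)
open import Relation.Nullary using (¬_)
open import Relation.Binary.PropositionalEquality
  using (_≡_; _≢_; refl; sym; trans; cong; subst; module ≡-Reasoning)

∣p∪⁅x⁆∣≡1+∣p∣ : ∀ {n} (p : Subset n) (x : Fin n) → x ∉ p → ∣ p ∪ ⁅ x ⁆ ∣ ≡ suc ∣ p ∣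
∣p∪⁅x⁆∣≡1+∣p∣ (outside ∷ p) zero    x∉p = cong (λ q → suc ∣ q ∣) (∪-identityʳ p)
∣p∪⁅x⁆∣≡1+∣p∣ (inside  ∷ p) zero    x∉p = ⊥-elim (x∉p here)
∣p∪⁅x⁆∣≡1+∣p∣ (outside ∷ p) (suc x) x∉p = ∣p∪⁅x⁆∣≡1+∣p∣ p x (x∉p ∘ there)
∣p∪⁅x⁆∣≡1+∣p∣ (inside  ∷ p) (suc x) x∉p = cong suc (∣p∪⁅x⁆∣≡1+∣p∣ p x (x∉p ∘ there))

p∪⁅x⁆-x≡p : ∀ {n} (p : Subset n) (x : Fin n) → x ∉ p → (p ∪ ⁅ x ⁆) - x ≡ p
p∪⁅x⁆-x≡p (outside ∷ p) zero    x∉p = cong (outside ∷_) (begin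
  (p ∪ ⊥) ─ ⊥ ≡⟨ cong (_─ ⊥) (∪-identityʳ p) ⟩
  p ─ ⊥       ≡⟨ p─⊥≡p p ⟩
  p           ∎)
  where open ≡-Reasoning
p∪⁅x⁆-x≡p (inside  ∷ p) zero    x∉p = ⊥-elim (x∉p here)
p∪⁅x⁆-x≡p (outside ∷ p) (suc x) x∉p = cong (outside ∷_) (p∪⁅x⁆-x≡p p x (x∉p ∘ there))
p∪⁅x⁆-x≡p (inside  ∷ p) (suc x) x∉p = cong (inside ∷_) (p∪⁅x⁆-x≡p p x (x∉p ∘ there))

∈p∪⁅y⁆-∉p⇒≡y : ∀ {n} (p : Subset n) (y : Fin n) {w : Fin n} → w ∈ p ∪ ⁅ y ⁆ → w ∉ p → w ≡ y
∈p∪⁅y⁆-∉p⇒≡y p y w∈p∪y w∉p with x∈p∪q⁻ p ⁅ y ⁆ w∈p∪y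
... | inj₁ w∈p = ⊥-elim (w∉p w∈p)
... | inj₂ w∈y = x∈⁅y⁆⇒x≡y y w∈y

∉p-≢y⇒∉p∪⁅y⁆ : ∀ {n} (p : Subset n) (y : Fin n) {w : Fin n} → w ∉ p → w ≢ y → w ∉ p ∪ ⁅ y ⁆
∉p-≢y⇒∉p∪⁅y⁆ p y w∉p w≢y w∈p∪y = w≢y (∈p∪⁅y⁆-∉p⇒≡y p y w∈p∪y w∉p)

-- Facts about a two-point extension p ∪ {x, z} with x, z ∉ p distinct,
-- obtained by viewing it as the one-point extension (p ∪ {z}) ∪ {x}.
module TwoPointExtension {n} (p : Subset n) (x z : Fin n) (x∉p : x ∉ p) (x≢z : x ≢ z) where

  x∉p∪z : x ∉ p ∪ ⁅ z ⁆
  x∉p∪z = ∉p-≢y⇒∉p∪⁅y⁆ p z x∉p x≢z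

  regroup : p ∪ (⁅ x ⁆ ∪ ⁅ z ⁆) ≡ (p ∪ ⁅ z ⁆) ∪ ⁅ x ⁆
  regroup = begin
    p ∪ (⁅ x ⁆ ∪ ⁅ z ⁆) ≡⟨ cong (p ∪_) (∪-comm ⁅ x ⁆ ⁅ z ⁆) ⟩
    p ∪ (⁅ z ⁆ ∪ ⁅ x ⁆) ≡⟨ sym (∪-assoc p ⁅ z ⁆ ⁅ x ⁆) ⟩
    (p ∪ ⁅ z ⁆) ∪ ⁅ x ⁆ ∎
    where open ≡-Reasoning

  cardinality : z ∉ p → ∣ p ∪ (⁅ x ⁆ ∪ ⁅ z ⁆) ∣ ≡ suc (suc ∣ p ∣)
  cardinality z∉p = begin
    ∣ p ∪ (⁅ x ⁆ ∪ ⁅ z ⁆) ∣   ≡⟨ cong ∣_∣ regroup ⟩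
    ∣ (p ∪ ⁅ z ⁆) ∪ ⁅ x ⁆ ∣   ≡⟨ ∣p∪⁅x⁆∣≡1+∣p∣ (p ∪ ⁅ z ⁆) x x∉p∪z ⟩
    suc ∣ p ∪ ⁅ z ⁆ ∣         ≡⟨ cong suc (∣p∪⁅x⁆∣≡1+∣p∣ p z z∉p) ⟩
    suc (suc ∣ p ∣)           ∎
    where open ≡-Reasoning

  remove-x : (p ∪ (⁅ x ⁆ ∪ ⁅ z ⁆)) - x ≡ p ∪ ⁅ z ⁆
  remove-x = begin
    (p ∪ (⁅ x ⁆ ∪ ⁅ z ⁆)) - x  ≡⟨ cong (_- x) regroup ⟩
    ((p ∪ ⁅ z ⁆) ∪ ⁅ x ⁆) - x  ≡⟨ p∪⁅x⁆-x≡p (p ∪ ⁅ z ⁆) x x∉p∪z ⟩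
    p ∪ ⁅ z ⁆                  ∎
    where open ≡-Reasoning

  other-point : ∀ {w} → w ∈ p ∪ (⁅ x ⁆ ∪ ⁅ z ⁆) → w ∉ p → w ≢ x → w ≡ z
  other-point w∈ w∉p w≢x = ∈p∪⁅y⁆-∉p⇒≡y (p ∪ ⁅ x ⁆) z
    (subst (_ ∈_) (sym (∪-assoc p ⁅ x ⁆ ⁅ z ⁆)) w∈)
    (∉p-≢y⇒∉p∪⁅y⁆ p x w∉p w≢x)

-- In a strong greedoid, the exchange element can be chosen different from
-- any x for which B ∖ {x} is infeasible: the element w supplied by axiom (iv)
-- has B ∖ {w} feasible, so w ≠ x.
strongExchange-avoiding : ∀ {ℓ n} {F : Subset n → Set ℓ} → IsStrongGreedoid n F →
  ∀ A B (x : Fin n) → F A → F B → ∣ B ∣ ≡ ∣ A ∣ + 1 → ¬ F (B - x) →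
  Σ (Fin n) λ w → w ∈ B × w ∉ A × w ≢ x × F (A ∪ ⁅ w ⁆)
strongExchange-avoiding {F = F} SG A B x FA FB ∣B∣≡∣A∣+1 ¬F[B-x]
  with IsStrongGreedoid.strongExchange SG A B FA FB ∣B∣≡∣A∣+1
... | w , w∈B , w∉A , F[A∪w] , F[B-w] =
  w , w∈B , w∉A , (λ w≡x → ¬F[B-x] (subst (λ v → F (B - v)) w≡x F[B-w])) , F[A∪w]

lemma7p4 : (n : ℕ) (F : Subset n → Set) → IsStrongGreedoid n F →
           (D : Subset n) (x y z : Fin n) → x ∉ D → y ∉ D → z ∉ D →
           F (D ∪ (⁅ x ⁆ ∪ ⁅ z ⁆)) → F (D ∪ ⁅ y ⁆) → ¬ F (D ∪ ⁅ z ⁆) →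
           F (D ∪ (⁅ y ⁆ ∪ ⁅ z ⁆))
lemma7p4 n F SG D x y z x∉D y∉D z∉D F[D∪xz] F[D∪y] ¬F[D∪z] =
  conclude (strongExchange-avoiding SG (D ∪ ⁅ y ⁆) (D ∪ (⁅ x ⁆ ∪ ⁅ z ⁆)) x
              F[D∪y] F[D∪xz] sizes (¬F[D∪z] ∘ subst F remove-x))
  where
  -- x ≠ z, for otherwise D ∪ {x, z} = D ∪ {z} would be feasible.
  x≢z : x ≢ z
  x≢z refl = ¬F[D∪z] (subst F (cong (D ∪_) (∪-idem ⁅ x ⁆)) F[D∪xz])

  open TwoPointExtension D x z x∉D x≢z

  sizes : ∣ D ∪ (⁅ x ⁆ ∪ ⁅ z ⁆) ∣ ≡ ∣ D ∪ ⁅ y ⁆ ∣ + 1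
  sizes = trans (cardinality z∉D)
                (trans (cong suc (sym (∣p∪⁅x⁆∣≡1+∣p∣ D y y∉D))) (+-comm 1 _))

  -- The exchange element w lies outside D ∪ {y} ⊇ D and differs from x, so w = z.
  conclude : (Σ (Fin n) λ w → w ∈ D ∪ (⁅ x ⁆ ∪ ⁅ z ⁆) × w ∉ D ∪ ⁅ y ⁆ × w ≢ x × F ((D ∪ ⁅ y ⁆) ∪ ⁅ w ⁆)) →
             F (D ∪ (⁅ y ⁆ ∪ ⁅ z ⁆))
  conclude (w , w∈B , w∉D∪y , w≢x , F[D∪y∪w]) =
    subst (λ v → F (D ∪ (⁅ y ⁆ ∪ ⁅ v ⁆)))
          (other-point w∈B (w∉D∪y ∘ p⊆p∪q ⁅ y ⁆) w≢x)
          (subst F (∪-assoc D ⁅ y ⁆ ⁅ w ⁆) F[D∪y∪w])
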